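{- Let $n\ge 0$ and let $a_0,\ldots,a_{2n+1},b$ be nonnegative integers, and set $S=\sum_{0\le i\le 2n+1,\ i \text{ even}} a_i$. Then $$o^-\Big(\sum_{i=0}^{2n+1}a_i\tau^i+b\,\mathsf{L}(\tau^{2n+1})\Big)=\begin{cases}\mathcal{R} & \text{if } a_i=0 \text{ for all } i \text{ and } b\equiv 1 \pmod 2,\\ \mathcal{N} & \text{if } S+b\equiv 0\pmod 2,\\ \mathcal{P} & \text{if } S+b\equiv 1\pmod 2 \text{ and } a_i\neq 0 \text{ for some } i.\end{cases}$$
   Context: A position $\xi=\{\xi^L \mid \xi^R\}$ is given recursively by finite sets of Left and Right options; $\cdot$ denotes an empty set. $*=\{0\mid0\}$, $\tau^0=*$, $\tau^k=\{\tau^{k-1}\mid\tau^{k-1}\}$ for $k\ge1$, and $\mathsf{L}(\xi)=\{\xi\mid\cdot\}$. $k\xi$ denotes the disjunctive sum of $k$ copies of $\xi$; disjunctive sum: $\alpha+\beta=\{\alpha^L+\beta,\alpha+\beta^L \mid \alpha^R+\beta,\alpha+\beta^R\}$. Under misère play a player unable to move on their turn wins; the misère outcome $o^-$ is $\mathcal{L}$ (Left wins moving first or second), $\mathcal{R}$ (Right wins moving first or second), $\mathcal{N}$ (next player wins) or $\mathcal{P}$ (next player loses). -}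

module Defs where

open import Data.Nat using (ℕ; zero; suc)
open import Data.Bool using (Bool; true; false; _∧_; _∨_; not)
open import Data.List using (List; []; _∷_; _++_)
open import Data.Fin using (Fin; toℕ) renaming (zero to fzero; suc to fsuc)
open import Data.Nat.DivMod using (_%_)

data Game : Set where
  ⟨_∣_⟩ : List Game → List Game → Game

𝟘 : Game
𝟘 = ⟨ [] ∣ [] ⟩

star : Game
star = ⟨ 𝟘 ∷ [] ∣ 𝟘 ∷ [] ⟩

τ : ℕ → Game
τ zero = star
τ (suc k) = ⟨ τ k ∷ [] ∣ τ k ∷ [] ⟩

𝐋 : Game → Game
𝐋 g = ⟨ g ∷ [] ∣ [] ⟩

mutual
  infixl 6 _⊕_
  _⊕_ : Game → Game → Game
  ⟨ aL ∣ aR ⟩ ⊕ ⟨ bL ∣ bR ⟩ =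
    ⟨ leftSum aL ⟨ bL ∣ bR ⟩ ++ rightSum ⟨ aL ∣ aR ⟩ bL
    ∣ leftSum aR ⟨ bL ∣ bR ⟩ ++ rightSum ⟨ aL ∣ aR ⟩ bR ⟩

  leftSum : List Game → Game → List Game
  leftSum [] β = []
  leftSum (x ∷ xs) β = (x ⊕ β) ∷ leftSum xs β

  rightSum : Game → List Game → List Game
  rightSum α [] = []
  rightSum α (y ∷ ys) = (α ⊕ y) ∷ rightSum α ys

_·_ : ℕ → Game → Game
zero · g = 𝟘
suc k · g = g ⊕ (k · g)

ΣG : (m : ℕ) → (Fin m → Game) → Game
ΣG zero f = 𝟘
ΣG (suc m) f = f fzero ⊕ ΣG m (λ i → f (fsuc i))

Σℕ : (m : ℕ) → (Fin m → ℕ) → ℕ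
Σℕ zero f = 0
Σℕ (suc m) f = f fzero Data.Nat.+ Σℕ m (λ i → f (fsuc i))

-- Misère play: a player unable to move wins.
-- leftWinsFirst g  : Left, moving first in g, wins.
-- leftWinsSecond g : Left wins when Right moves first in g.
mutual
  leftWinsFirst : Game → Bool
  leftWinsFirst ⟨ [] ∣ R ⟩ = true
  leftWinsFirst ⟨ x ∷ L ∣ R ⟩ = anyLWS (x ∷ L)

  leftWinsSecond : Game → Bool
  leftWinsSecond ⟨ L ∣ [] ⟩ = false
  leftWinsSecond ⟨ L ∣ y ∷ R ⟩ = allLWF (y ∷ R)

  anyLWS : List Game → Bool
  anyLWS [] = false
  anyLWS (g ∷ gs) = leftWinsSecond g ∨ anyLWS gs

  allLWF : List Game → Bool
  allLWF [] = true
  allLWF (g ∷ gs) = leftWinsFirst g ∧ allLWF gs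

data Outcome : Set where
  𝓛 𝓡 𝓝 𝓟 : Outcome

outcome : Bool → Bool → Outcome
outcome true  true  = 𝓛
outcome true  false = 𝓝
outcome false true  = 𝓟
outcome false false = 𝓡

o⁻ : Game → Outcome
o⁻ g = outcome (leftWinsFirst g) (leftWinsSecond g)

evenSum : (m : ℕ) → (Fin m → ℕ) → ℕ
evenSum m a = Σℕ m (λ i → evenPart (toℕ i % 2) (a i))
  where
  evenPart : ℕ → ℕ → ℕ
  evenPart zero x = x
  evenPart (suc _) x = 0

module Submission where

-- Idea.  τᵏ is a path of k+1 moves open to both players, and L(τᵏ) is a
-- "switch" that only Left may throw and that then releases such a path of
-- k+1 moves.  So the position is governed by two counts: the number T of
-- tempo moves lying on the board and the number c of unthrown switches.  We
-- capture this by the predicate  TempoGame T c g  (for a fixed length M of the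
-- path released by a switch) saying that every option of g is one of these
-- moves and every available move is realised by an option.  It is closed
-- under disjunctive sum, with the counts adding up, and holds for 0, τᵏ and
-- L(τᵏ); hence  Σ aᵢτⁱ + b·L(τᵏ)  is a tempo game with  T = Σ aᵢ(i+1)  and
-- c = b.  When M is even, the misère outcome of a tempo game depends only on
-- T and c: Left moving first wins iff T + c is even, and Left moving second
-- wins iff T > 0 and T + c is odd.  The theorem follows because T and the
-- sum S of the aᵢ with i even have the same parity.

open import Defs
open import Data.Nat using (ℕ; zero; suc; _+_; _*_; parity)
open import Data.Nat.DivMod using (_%_)
open import Data.Nat.Properties
  using (+-assoc; +-suc; +-identityʳ; *-zeroʳ; *-identityʳ; m+n≡0⇒m≡0; m+n≡0⇒n≡0; m*n≡0⇒m≡0; +-commutativeSemigroup)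
open import Algebra.Properties.CommutativeSemigroup +-commutativeSemigroup using (xy∙z≈xz∙y)
open import Data.Parity.Base as ℙ using (Parity; 0ℙ; 1ℙ; _⁻¹)
open import Data.Parity.Properties using (+-homo-+; *-homo-*; suc-homo-⁻¹) renaming (*-zeroʳ to ℙ-*-zeroʳ)
open import Data.Bool using (Bool; true; false)
open import Data.Bool.Properties using (∧-identityʳ; ∧-idem; ∨-zeroʳ)
open import Data.List using ([]; _∷_; _++_)
open import Data.List.Relation.Unary.All using (All; []; _∷_)
open import Data.List.Relation.Unary.All.Properties using (++⁺)
open import Data.List.Relation.Unary.Any as Any using (Any; here; there)
open import Data.List.Relation.Unary.Any.Properties using (++⁺ˡ; ++⁺ʳ; ¬Any[])
open import Data.Fin using (Fin; toℕ) renaming (zero to fzero; suc to fsuc)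
open import Data.Product using (_×_; _,_; ∃)
open import Data.Empty using (⊥-elim)
open import Function using (_∘_)
open import Relation.Binary.PropositionalEquality

parity-%2 : ∀ n → parity n ≡ parity (n % 2)
parity-%2 zero          = refl
parity-%2 (suc zero)    = refl
parity-%2 (suc (suc n)) = parity-%2 n

isEven : Parity → Bool
isEven 0ℙ = true
isEven 1ℙ = false

parity-pred : ∀ {p} n → parity (suc n) ≡ p → parity n ≡ p ⁻¹
parity-pred n eq = trans (sym (suc-homo-⁻¹ n)) (cong _⁻¹ eq)

parity-Σℕ-cong : ∀ m (f g : Fin m → ℕ) → (∀ i → parity (f i) ≡ parity (g i))
               → parity (Σℕ m f) ≡ parity (Σℕ m g)
parity-Σℕ-cong zero    f g same = refl
parity-Σℕ-cong (suc m) f g same = begin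
  parity (f fzero + Σℕ m (f ∘ fsuc))              ≡⟨ +-homo-+ (f fzero) _ ⟩
  parity (f fzero) ℙ.+ parity (Σℕ m (f ∘ fsuc))   ≡⟨ cong₂ ℙ._+_ (same fzero) (parity-Σℕ-cong m _ _ (same ∘ fsuc)) ⟩
  parity (g fzero) ℙ.+ parity (Σℕ m (g ∘ fsuc))   ≡⟨ sym (+-homo-+ (g fzero) _) ⟩
  parity (g fzero + Σℕ m (g ∘ fsuc))              ∎
  where open ≡-Reasoning

parity-*-cong : ∀ x {w w′} → parity w ≡ parity w′ → parity (x * w) ≡ parity (x * w′)
parity-*-cong x {w} {w′} eq =
  trans (*-homo-* x w) (trans (cong (parity x ℙ.*_) eq) (sym (*-homo-* x w′)))

Σℕ-zero : ∀ m (f : Fin m → ℕ) → (∀ i → f i ≡ 0) → Σℕ m f ≡ 0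
Σℕ-zero zero    f all0 = refl
Σℕ-zero (suc m) f all0 rewrite all0 fzero = Σℕ-zero m (f ∘ fsuc) (all0 ∘ fsuc)

Σℕ-zero⁻ : ∀ m (f : Fin m → ℕ) → Σℕ m f ≡ 0 → ∀ i → f i ≡ 0
Σℕ-zero⁻ (suc m) f eq fzero    = m+n≡0⇒m≡0 (f fzero) eq
Σℕ-zero⁻ (suc m) f eq (fsuc i) = Σℕ-zero⁻ m (f ∘ fsuc) (m+n≡0⇒n≡0 (f fzero) eq) i

-- The number of tempo moves in Σ aᵢ τⁱ: the path τⁱ has i+1 moves.
tempoCount : ∀ m → (Fin m → ℕ) → ℕ
tempoCount m a = Σℕ m (λ i → a i * suc (toℕ i))

-- Only the terms of odd weight i+1, i.e. of even index i, count modulo 2.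
parity-tempoCount : ∀ m (a : Fin m → ℕ) → parity (tempoCount m a) ≡ parity (evenSum m a)
parity-tempoCount zero          a = refl
parity-tempoCount (suc zero)    a = cong (λ x → parity (x + 0)) (*-identityʳ (a fzero))
parity-tempoCount (suc (suc m)) a = begin
  parity (a fzero * 1 + (a₁ * 2 + rest))                 ≡⟨ +-homo-+ (a fzero * 1) _ ⟩
  parity (a fzero * 1) ℙ.+ parity (a₁ * 2 + rest)        ≡⟨ cong₂ ℙ._+_ (cong parity (*-identityʳ (a fzero))) restParity ⟩
  parity (a fzero) ℙ.+ parity (evenSum m a′)              ≡⟨ sym (+-homo-+ (a fzero) _) ⟩
  parity (a fzero + evenSum m a′)                         ∎
  where
  open ≡-Reasoning
  a₁ : ℕ
  a₁ = a (fsuc fzero)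
  a′ : Fin m → ℕ
  a′ = a ∘ fsuc ∘ fsuc
  rest : ℕ
  rest = Σℕ m (λ i → a′ i * suc (suc (suc (toℕ i))))
  -- the even weight 2 drops out, and shifting the weights by 2 keeps parities
  restParity : parity (a₁ * 2 + rest) ≡ parity (evenSum m a′)
  restParity = begin
    parity (a₁ * 2 + rest)                   ≡⟨ +-homo-+ (a₁ * 2) rest ⟩
    parity (a₁ * 2) ℙ.+ parity rest          ≡⟨ cong (ℙ._+ parity rest) (trans (*-homo-* a₁ 2) (ℙ-*-zeroʳ (parity a₁))) ⟩
    parity rest                              ≡⟨ parity-Σℕ-cong m _ _ (λ i → parity-*-cong (a′ i) refl) ⟩
    parity (tempoCount m a′)                 ≡⟨ parity-tempoCount m a′ ⟩
    parity (evenSum m a′)                    ∎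

tempoCount-zero : ∀ m (a : Fin m → ℕ) → (∀ i → a i ≡ 0) → tempoCount m a ≡ 0
tempoCount-zero m a all0 = Σℕ-zero m _ (λ i → cong (_* suc (toℕ i)) (all0 i))

tempoCount-nonzero : ∀ m (a : Fin m → ℕ) i → a i ≢ 0 → tempoCount m a ≢ 0
tempoCount-nonzero m a i aᵢ≢0 eq = aᵢ≢0 (m*n≡0⇒m≡0 (a i) (suc (toℕ i)) (Σℕ-zero⁻ m _ eq i))

anyLWS-true : ∀ {xs} → Any (λ x → leftWinsSecond x ≡ true) xs → anyLWS xs ≡ true
anyLWS-true (here win) rewrite win = refl
anyLWS-true {x ∷ xs} (there wins) rewrite anyLWS-true wins = ∨-zeroʳ (leftWinsSecond x)

anyLWS-false : ∀ {xs} → All (λ x → leftWinsSecond x ≡ false) xs → anyLWS xs ≡ false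
anyLWS-false []             = refl
anyLWS-false (lose ∷ loses) rewrite lose | anyLWS-false loses = refl

allLWF-const : ∀ {v x xs} → All (λ y → leftWinsFirst y ≡ v) (x ∷ xs) → allLWF (x ∷ xs) ≡ v
allLWF-const {v} (same ∷ [])                         rewrite same = ∧-identityʳ v
allLWF-const {v} {xs = _ ∷ _} (same ∷ others@(_ ∷ _)) rewrite same | allLWF-const others = ∧-idem v

module TempoGames (M : ℕ) where

  mutual
    -- `TempoGame T c g`: g plays like T tempo moves open to both players plus c
    -- switches for Left, each of which releases M further tempo moves.
    data TempoGame : ℕ → ℕ → Game → Set where
      tempoGame : ∀ {T c L R} → All (LeftMove T c) L → All (RightMove T c) R
        → (∀ {T′} → T ≡ suc T′ → Any (TempoGame T′ c) L)
        → (∀ {c′} → c ≡ suc c′ → Any (TempoGame (T + M) c′) L)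
        → (∀ {T′} → T ≡ suc T′ → Any (TempoGame T′ c) R)
        → TempoGame T c ⟨ L ∣ R ⟩

    data LeftMove (T c : ℕ) (x : Game) : Set where
      leftTempo : ∀ {T′} → T ≡ suc T′ → TempoGame T′ c x → LeftMove T c x
      switch    : ∀ {c′} → c ≡ suc c′ → TempoGame (T + M) c′ x → LeftMove T c x

    data RightMove (T c : ℕ) (x : Game) : Set where
      rightTempo : ∀ {T′} → T ≡ suc T′ → TempoGame T′ c x → RightMove T c x

  -- Transport along equal counts (sums of counts rarely agree definitionally).
  retag : ∀ {T T′ c c′ g} → T ≡ T′ → c ≡ c′ → TempoGame T c g → TempoGame T′ c′ g
  retag refl refl t = t

  mutual
    tempo-⊕ : ∀ {T₁ c₁ T₂ c₂ g h} → TempoGame T₁ c₁ g → TempoGame T₂ c₂ h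
            → TempoGame (T₁ + T₂) (c₁ + c₂) (g ⊕ h)
    tempo-⊕ {g = ⟨ _ ∣ _ ⟩} {⟨ _ ∣ _ ⟩} g@(tempoGame gL gR _ _ _) h@(tempoGame hL hR _ _ _) =
      tempoGame (++⁺ (leftSum-left gL h) (rightSum-left g hL))
                (++⁺ (leftSum-right gR h) (rightSum-right g hR))
                (leftTempo-⊕ g h) (switch-⊕ g h) (rightTempo-⊕ g h)

    leftSum-left : ∀ {T₁ c₁ T₂ c₂ h xs} → All (LeftMove T₁ c₁) xs → TempoGame T₂ c₂ h
                 → All (LeftMove (T₁ + T₂) (c₁ + c₂)) (leftSum xs h)
    leftSum-left [] h = []
    leftSum-left (leftTempo refl x ∷ xs) h = leftTempo refl (tempo-⊕ x h) ∷ leftSum-left xs h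
    leftSum-left {T₁} {T₂ = T₂} (switch refl x ∷ xs) h =
      switch refl (retag (xy∙z≈xz∙y T₁ M T₂) refl (tempo-⊕ x h)) ∷ leftSum-left xs h

    rightSum-left : ∀ {T₁ c₁ T₂ c₂ g ys} → TempoGame T₁ c₁ g → All (LeftMove T₂ c₂) ys
                  → All (LeftMove (T₁ + T₂) (c₁ + c₂)) (rightSum g ys)
    rightSum-left g [] = []
    rightSum-left {T₁} g (leftTempo refl y ∷ ys) =
      leftTempo (+-suc T₁ _) (tempo-⊕ g y) ∷ rightSum-left g ys
    rightSum-left {T₁} {c₁} {T₂} g (switch refl y ∷ ys) =
      switch (+-suc c₁ _) (retag (sym (+-assoc T₁ T₂ M)) refl (tempo-⊕ g y)) ∷ rightSum-left g ys

    leftSum-right : ∀ {T₁ c₁ T₂ c₂ h xs} → All (RightMove T₁ c₁) xs → TempoGame T₂ c₂ h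
                  → All (RightMove (T₁ + T₂) (c₁ + c₂)) (leftSum xs h)
    leftSum-right [] h = []
    leftSum-right (rightTempo refl x ∷ xs) h = rightTempo refl (tempo-⊕ x h) ∷ leftSum-right xs h

    rightSum-right : ∀ {T₁ c₁ T₂ c₂ g ys} → TempoGame T₁ c₁ g → All (RightMove T₂ c₂) ys
                   → All (RightMove (T₁ + T₂) (c₁ + c₂)) (rightSum g ys)
    rightSum-right g [] = []
    rightSum-right {T₁} g (rightTempo refl y ∷ ys) =
      rightTempo (+-suc T₁ _) (tempo-⊕ g y) ∷ rightSum-right g ys

    leftSum-any : ∀ {T₁ c₁ T₂ c₂ h xs} → Any (TempoGame T₁ c₁) xs → TempoGame T₂ c₂ h
                → Any (TempoGame (T₁ + T₂) (c₁ + c₂)) (leftSum xs h)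
    leftSum-any (here x)  h = here (tempo-⊕ x h)
    leftSum-any (there x) h = there (leftSum-any x h)

    rightSum-any : ∀ {T₁ c₁ T₂ c₂ g ys} → TempoGame T₁ c₁ g → Any (TempoGame T₂ c₂) ys
                 → Any (TempoGame (T₁ + T₂) (c₁ + c₂)) (rightSum g ys)
    rightSum-any g (here y)  = here (tempo-⊕ g y)
    rightSum-any g (there y) = there (rightSum-any g y)

    leftTempo-⊕ : ∀ {T₁ c₁ T₂ c₂ aL aR bL bR} → TempoGame T₁ c₁ ⟨ aL ∣ aR ⟩ → TempoGame T₂ c₂ ⟨ bL ∣ bR ⟩
                → ∀ {T′} → T₁ + T₂ ≡ suc T′
                → Any (TempoGame T′ (c₁ + c₂)) (leftSum aL ⟨ bL ∣ bR ⟩ ++ rightSum ⟨ aL ∣ aR ⟩ bL)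
    leftTempo-⊕ {suc _} g@(tempoGame _ _ hasTempo _ _) h refl = ++⁺ˡ (leftSum-any (hasTempo refl) h)
    leftTempo-⊕ {zero}  g (tempoGame _ _ hasTempo _ _) eq    = ++⁺ʳ _ (rightSum-any g (hasTempo eq))

    rightTempo-⊕ : ∀ {T₁ c₁ T₂ c₂ aL aR bL bR} → TempoGame T₁ c₁ ⟨ aL ∣ aR ⟩ → TempoGame T₂ c₂ ⟨ bL ∣ bR ⟩
                 → ∀ {T′} → T₁ + T₂ ≡ suc T′
                 → Any (TempoGame T′ (c₁ + c₂)) (leftSum aR ⟨ bL ∣ bR ⟩ ++ rightSum ⟨ aL ∣ aR ⟩ bR)
    rightTempo-⊕ {suc _} g@(tempoGame _ _ _ _ hasTempo) h refl = ++⁺ˡ (leftSum-any (hasTempo refl) h)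
    rightTempo-⊕ {zero}  g (tempoGame _ _ _ _ hasTempo) eq    = ++⁺ʳ _ (rightSum-any g (hasTempo eq))

    switch-⊕ : ∀ {T₁ c₁ T₂ c₂ aL aR bL bR} → TempoGame T₁ c₁ ⟨ aL ∣ aR ⟩ → TempoGame T₂ c₂ ⟨ bL ∣ bR ⟩
             → ∀ {c′} → c₁ + c₂ ≡ suc c′
             → Any (TempoGame (T₁ + T₂ + M) c′) (leftSum aL ⟨ bL ∣ bR ⟩ ++ rightSum ⟨ aL ∣ aR ⟩ bL)
    switch-⊕ {T₁} {suc _} {T₂} g@(tempoGame _ _ _ hasSwitch _) h refl =
      ++⁺ˡ (Any.map (retag (xy∙z≈xz∙y T₁ M T₂) refl) (leftSum-any (hasSwitch refl) h))
    switch-⊕ {T₁} {zero} {T₂} g (tempoGame _ _ _ hasSwitch _) eq =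
      ++⁺ʳ _ (Any.map (retag (sym (+-assoc T₁ T₂ M)) refl) (rightSum-any g (hasSwitch eq)))

  tempo-𝟘 : TempoGame 0 0 𝟘
  tempo-𝟘 = tempoGame [] [] (λ ()) (λ ()) (λ ())

  tempo-node : ∀ {T x} → TempoGame T 0 x → TempoGame (suc T) 0 ⟨ x ∷ [] ∣ x ∷ [] ⟩
  tempo-node t = tempoGame (leftTempo refl t ∷ []) (rightTempo refl t ∷ [])
                            (λ { refl → here t }) (λ ()) (λ { refl → here t })

  tempo-τ : ∀ k → TempoGame (suc k) 0 (τ k)
  tempo-τ zero    = tempo-node tempo-𝟘
  tempo-τ (suc k) = tempo-node (tempo-τ k)

  tempo-𝐋 : ∀ {g} → TempoGame M 0 g → TempoGame 0 1 (𝐋 g)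
  tempo-𝐋 t = tempoGame (switch refl t ∷ []) [] (λ ()) (λ { refl → here t }) (λ ())

  tempo-· : ∀ {T c g} k → TempoGame T c g → TempoGame (k * T) (k * c) (k · g)
  tempo-· zero    t = tempo-𝟘
  tempo-· (suc k) t = tempo-⊕ t (tempo-· k t)

  tempo-Σ : ∀ m (t : Fin m → ℕ) (f : Fin m → Game) → (∀ i → TempoGame (t i) 0 (f i))
          → TempoGame (Σℕ m t) 0 (ΣG m f)
  tempo-Σ zero    t f ts = tempo-𝟘
  tempo-Σ (suc m) t f ts = tempo-⊕ (ts fzero) (tempo-Σ m (t ∘ fsuc) (f ∘ fsuc) (ts ∘ fsuc))

-- The predicted outcome of a tempo game with T tempo moves and c switches:
-- moving first, Left wins iff the total number T + c of remaining moves is even;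
-- moving second, Left loses at once if T = 0 (Right cannot move) and otherwise
-- Right's best reply is a tempo move, after which Left moves first.
firstWins : ℕ → ℕ → Bool
firstWins T c = isEven (parity (T + c))

secondWins : ℕ → ℕ → Bool
secondWins zero    c = false
secondWins (suc T) c = firstWins T c

tempoOutcome : ℕ → ℕ → Outcome
tempoOutcome T c = outcome (firstWins T c) (secondWins T c)

secondWins-afterTempo : ∀ T c → firstWins (suc T) c ≡ false → secondWins T c ≡ false
secondWins-afterTempo zero    c lose = refl
secondWins-afterTempo (suc T) c lose = lose

secondWins-afterTempo₀ : ∀ T → secondWins T 0 ≡ firstWins (suc T) 0
secondWins-afterTempo₀ zero    = refl
secondWins-afterTempo₀ (suc T) = refl

-- Throwing a switch releasing an even number suc h of tempo moves preserves
-- the parity of T + c, so it does not change who wins.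
secondWins-afterSwitch : ∀ {h} → parity h ≡ 1ℙ → ∀ T c → secondWins (T + suc h) c ≡ firstWins T (suc c)
secondWins-afterSwitch {h} h-odd T c = begin
  secondWins (T + suc h) c           ≡⟨ cong (λ T′ → secondWins T′ c) (+-suc T h) ⟩
  isEven (parity (T + h + c))        ≡⟨ cong (isEven ∘ parity) (+-assoc T h c) ⟩
  isEven (parity (T + (h + c)))      ≡⟨ cong isEven (+-homo-+ T (h + c)) ⟩
  isEven (parity T ℙ.+ parity (h + c)) ≡⟨ cong (λ p → isEven (parity T ℙ.+ p)) h+c≡suc-c ⟩
  isEven (parity T ℙ.+ parity (suc c)) ≡⟨ cong isEven (sym (+-homo-+ T (suc c))) ⟩
  firstWins T (suc c)                ∎
  where
  open ≡-Reasoning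
  h+c≡suc-c : parity (h + c) ≡ parity (suc c)
  h+c≡suc-c = trans (+-homo-+ h c) (trans (cong (ℙ._+ parity c) h-odd) (sym (+-homo-+ 1 c)))

module Outcomes (h : ℕ) (h-odd : parity h ≡ 1ℙ) where
  open TempoGames (suc h)

  mutual
    leftWinsFirst-tempo : ∀ {T c g} → TempoGame T c g → leftWinsFirst g ≡ firstWins T c
    leftWinsFirst-tempo {zero}  {zero}  (tempoGame {L = []} _ _ _ _ _)        = refl
    leftWinsFirst-tempo {suc T}         (tempoGame {L = []} _ _ hasTempo _ _)  = ⊥-elim (¬Any[] (hasTempo refl))
    leftWinsFirst-tempo {zero}  {suc c} (tempoGame {L = []} _ _ _ hasSwitch _) = ⊥-elim (¬Any[] (hasSwitch refl))
    leftWinsFirst-tempo {T} {c} (tempoGame {L = _ ∷ _} moves _ hasTempo hasSwitch _) with firstWins T c in win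
    ... | true  = anyLWS-true (winningMove T c win hasTempo hasSwitch moves)
    ... | false = anyLWS-false (losingMoves moves win)

    leftWinsSecond-tempo : ∀ {T c g} → TempoGame T c g → leftWinsSecond g ≡ secondWins T c
    leftWinsSecond-tempo {zero}  (tempoGame {R = []} _ _ _ _ _)        = refl
    leftWinsSecond-tempo {suc T} (tempoGame {R = []} _ _ _ _ hasTempo) = ⊥-elim (¬Any[] (hasTempo refl))
    leftWinsSecond-tempo (tempoGame {R = _ ∷ _} _ moves _ _ _)          = allLWF-const (rightReplies moves)

    -- If T + c is even, Left throws a switch if one is left, and otherwise takes a tempo move.
    winningMove : ∀ T c {x L} → firstWins T c ≡ true
      → (∀ {T′} → T ≡ suc T′ → Any (TempoGame T′ c) (x ∷ L))
      → (∀ {c′} → c ≡ suc c′ → Any (TempoGame (T + suc h) c′) (x ∷ L))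
      → All (LeftMove T c) (x ∷ L)
      → Any (λ y → leftWinsSecond y ≡ true) (x ∷ L)
    winningMove T (suc c) win _ hasSwitch _ =
      Any.map (λ e → trans e (trans (secondWins-afterSwitch h-odd T c) win)) (secondWinsOf (hasSwitch refl))
    winningMove (suc T) zero win hasTempo _ _ =
      Any.map (λ e → trans e (trans (secondWins-afterTempo₀ T) win)) (secondWinsOf (hasTempo refl))
    winningMove zero zero _ _ _ (leftTempo () _ ∷ _)
    winningMove zero zero _ _ _ (switch () _ ∷ _)

    losingMoves : ∀ {T c L} → All (LeftMove T c) L → firstWins T c ≡ false
                → All (λ y → leftWinsSecond y ≡ false) L
    losingMoves [] lose = []
    losingMoves {c = c} (leftTempo {T} refl x ∷ moves) lose =
      trans (leftWinsSecond-tempo x) (secondWins-afterTempo T c lose) ∷ losingMoves moves lose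
    losingMoves {T} (switch {c} refl x ∷ moves) lose =
      trans (leftWinsSecond-tempo x) (trans (secondWins-afterSwitch h-odd T c) lose) ∷ losingMoves moves lose

    rightReplies : ∀ {T c R} → All (RightMove T c) R → All (λ y → leftWinsFirst y ≡ secondWins T c) R
    rightReplies []                          = []
    rightReplies (rightTempo refl x ∷ moves) = leftWinsFirst-tempo x ∷ rightReplies moves

    secondWinsOf : ∀ {T c L} → Any (TempoGame T c) L → Any (λ y → leftWinsSecond y ≡ secondWins T c) L
    secondWinsOf (here x)  = here (leftWinsSecond-tempo x)
    secondWinsOf (there x) = there (secondWinsOf x)

  o⁻-tempo : ∀ {T c g} → TempoGame T c g → o⁻ g ≡ tempoOutcome T c
  o⁻-tempo t = cong₂ outcome (leftWinsFirst-tempo t) (leftWinsSecond-tempo t)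

tempoOutcome-𝓡 : ∀ c → parity c ≡ 1ℙ → tempoOutcome 0 c ≡ 𝓡
tempoOutcome-𝓡 c c-odd = cong (λ p → outcome (isEven p) false) c-odd

tempoOutcome-𝓝 : ∀ T c → parity (T + c) ≡ 0ℙ → tempoOutcome T c ≡ 𝓝
tempoOutcome-𝓝 zero    c even = cong (λ p → outcome (isEven p) false) even
tempoOutcome-𝓝 (suc T) c even = cong₂ outcome (cong isEven even) (cong isEven (parity-pred (T + c) even))

tempoOutcome-𝓟 : ∀ T c → T ≢ 0 → parity (T + c) ≡ 1ℙ → tempoOutcome T c ≡ 𝓟
tempoOutcome-𝓟 zero    c T≢0 odd = ⊥-elim (T≢0 refl)
tempoOutcome-𝓟 (suc T) c T≢0 odd = cong₂ outcome (cong isEven odd) (cong isEven (parity-pred (T + c) odd))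

module _ (k : ℕ) where
  open TempoGames (suc k)

  tempoPosition : ∀ m (a : Fin m → ℕ) b
                → TempoGame (tempoCount m a) b (ΣG m (λ i → a i · τ (toℕ i)) ⊕ (b · 𝐋 (τ k)))
  tempoPosition m a b =
    retag (trans (cong (tempoCount m a +_) (*-zeroʳ b)) (+-identityʳ _)) (*-identityʳ b) (tempo-⊕ paths switches)
    where
    paths : TempoGame (tempoCount m a) 0 (ΣG m (λ i → a i · τ (toℕ i)))
    paths = tempo-Σ m _ _ (λ i → retag refl (*-zeroʳ (a i)) (tempo-· (a i) (tempo-τ (toℕ i))))
    switches : TempoGame (b * 0) (b * 1) (b · 𝐋 (τ k))
    switches = tempo-· b (tempo-𝐋 (tempo-τ k))

-- 2n+1 is odd, so L(τ²ⁿ⁺¹) releases an even number of moves.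
parity-2n+1 : ∀ n → parity (2 * n + 1) ≡ 1ℙ
parity-2n+1 n = trans (+-homo-+ (2 * n) 1) (cong (ℙ._+ 1ℙ) (*-homo-* 2 n))

theorem3p4p4 : (n : ℕ) (a : Fin (2 * n + 2) → ℕ) (b : ℕ) →
    let G = ΣG (2 * n + 2) (λ i → a i · τ (toℕ i)) ⊕ (b · 𝐋 (τ (2 * n + 1)))
        S = evenSum (2 * n + 2) a
    in (((∀ i → a i ≡ 0) × (b % 2 ≡ 1)) → o⁻ G ≡ 𝓡)
     × (((S + b) % 2 ≡ 0) → o⁻ G ≡ 𝓝)
     × (((S + b) % 2 ≡ 1) → (∃ λ i → a i ≢ 0) → o⁻ G ≡ 𝓟)
theorem3p4p4 n a b = caseR , caseN , caseP
  where
  open Outcomes (2 * n + 1) (parity-2n+1 n)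
  m T S : ℕ
  m = 2 * n + 2
  T = tempoCount m a
  S = evenSum m a
  G : Game
  G = ΣG m (λ i → a i · τ (toℕ i)) ⊕ (b · 𝐋 (τ (2 * n + 1)))

  G-outcome : o⁻ G ≡ tempoOutcome T b
  G-outcome = o⁻-tempo (tempoPosition (2 * n + 1) m a b)

  T+b≡S+b : parity (T + b) ≡ parity (S + b)
  T+b≡S+b = trans (+-homo-+ T b) (trans (cong (ℙ._+ parity b) (parity-tempoCount m a)) (sym (+-homo-+ S b)))

  caseR : (∀ i → a i ≡ 0) × (b % 2 ≡ 1) → o⁻ G ≡ 𝓡
  caseR (all0 , b-odd) = begin
    o⁻ G              ≡⟨ G-outcome ⟩
    tempoOutcome T b  ≡⟨ cong (λ T′ → tempoOutcome T′ b) (tempoCount-zero m a all0) ⟩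
    tempoOutcome 0 b  ≡⟨ tempoOutcome-𝓡 b (trans (parity-%2 b) (cong parity b-odd)) ⟩
    𝓡                 ∎
    where open ≡-Reasoning

  caseN : (S + b) % 2 ≡ 0 → o⁻ G ≡ 𝓝
  caseN even = trans G-outcome (tempoOutcome-𝓝 T b (trans T+b≡S+b (trans (parity-%2 (S + b)) (cong parity even))))

  caseP : (S + b) % 2 ≡ 1 → ∃ (λ i → a i ≢ 0) → o⁻ G ≡ 𝓟
  caseP odd (i , aᵢ≢0) = trans G-outcome
    (tempoOutcome-𝓟 T b (tempoCount-nonzero m a i aᵢ≢0) (trans T+b≡S+b (trans (parity-%2 (S + b)) (cong parity odd))))
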